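{- Let $\mathcal{S}$ be a finite left regular band of groups. Define relations on $\mathcal{S}$ by $s\le t$ iff $st^\omega=t$, and $s\sim t$ iff ($s^\omega t=s$ and $t^\omega s=t$). Then $\le$ is a partial order on $\mathcal{S}$ and $\sim$ is a semigroup congruence (an equivalence relation such that $s\sim t$ implies $su\sim tu$ and $us\sim ut$ for all $u\in\mathcal{S}$).
   Context: For $s$ in a finite semigroup, $s^\omega$ denotes the unique idempotent that is a positive power of $s$. A finite semigroup $\mathcal{S}$ is a left regular band of groups if $s^\omega s=s$ and $sts^\omega=st$ for all $s,t\in\mathcal{S}$. -}

module Defs where

open import Level using (Level)
open import Data.Nat using (ℕ; zero; suc)
open import Data.Fin using (Fin)
open import Data.Product using (Σ; ∃; _×_)
open import Function.Bundles using (_↔_)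
open import Relation.Binary.PropositionalEquality using (_≡_)

private variable a : Level

-- positive powers: pow⁺ _∙_ s k = s^(k+1)
pow⁺ : {A : Set a} → (A → A → A) → A → ℕ → A
pow⁺ _∙_ s zero = s
pow⁺ _∙_ s (suc k) = pow⁺ _∙_ s k ∙ s

Finite : Set a → Set a
Finite A = ∃ λ n → A ↔ Fin n

-- ω is the omega-map: ω s is an idempotent positive power of s
-- (in a finite semigroup such an idempotent exists and is unique)
IsOmega : {A : Set a} → (A → A → A) → (A → A) → Set a
IsOmega {A = A} _∙_ ω =
  (s : A) → (ω s ∙ ω s ≡ ω s) × (∃ λ k → ω s ≡ pow⁺ _∙_ s k)

IsLRBG : {A : Set a} → (A → A → A) → (A → A) → Set a
IsLRBG {A = A} _∙_ ω =
  ((s : A) → ω s ∙ s ≡ s) × ((s t : A) → (s ∙ t) ∙ ω s ≡ s ∙ t)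

Leq : {A : Set a} → (A → A → A) → (A → A) → A → A → Set a
Leq _∙_ ω s t = s ∙ ω t ≡ t

Sim : {A : Set a} → (A → A → A) → (A → A) → A → A → Set a
Sim _∙_ ω s t = (ω s ∙ t ≡ s) × (ω t ∙ s ≡ t)

IsSemigroupCongruence : {A : Set a} → (A → A → A) → (A → A → Set a) → Set a
IsSemigroupCongruence {a} {A} _∙_ _∼_ =
  IsEquivalence′ × ((s t u : A) → s ∼ t → ((s ∙ u) ∼ (t ∙ u)) × ((u ∙ s) ∼ (u ∙ t)))
  where
  open import Relation.Binary.Structures using (IsEquivalence)
  IsEquivalence′ = IsEquivalence _∼_

-- Everything follows from two facts about the ω-map. Since ω s is a positive
-- power of s, a right identity s ∙ w ≡ s of s is also one of ω s. Since every
-- positive power of s ∙ x lies in the right ideal s ∙ A, the idempotent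
-- ω (s ∙ x) is absorbed by ω s from the left (by ω s ∙ s ≡ s) and from the
-- right (by the band law s ∙ y ∙ ω s ≡ s ∙ y).
module Submission where

open import Defs
open import Level using (Level)
open import Data.Nat using (ℕ; zero; suc)
open import Data.Product using (∃; _×_; _,_; proj₁; proj₂)
open import Algebra.Structures using (IsSemigroup)
open import Relation.Binary.Structures using (IsPartialOrder; IsEquivalence)
open import Relation.Binary.PropositionalEquality
open ≡-Reasoning

module PositivePowers {a : Level} {A : Set a} {_∙_ : A → A → A}
                      (isSemigroup : IsSemigroup _≡_ _∙_) where

  open IsSemigroup isSemigroup using (assoc)

  infixr 25 _^⁺_

  _^⁺_ : A → ℕ → A
  s ^⁺ k = pow⁺ _∙_ s k

  ^⁺-comm : ∀ s k → s ∙ s ^⁺ k ≡ s ^⁺ k ∙ s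
  ^⁺-comm s zero    = refl
  ^⁺-comm s (suc k) = trans (sym (assoc s _ s)) (cong (_∙ s) (^⁺-comm s k))

  ^⁺-fixʳ : ∀ s w k → s ∙ w ≡ s → s ^⁺ k ∙ w ≡ s ^⁺ k
  ^⁺-fixʳ s w zero    sw≡s = sw≡s
  ^⁺-fixʳ s w (suc k) sw≡s = trans (assoc _ s w) (cong (s ^⁺ k ∙_) sw≡s)

  ^⁺-square : ∀ x y k → x ∙ y ≡ x ∙ x → x ^⁺ k ∙ y ≡ x ^⁺ suc k
  ^⁺-square x y zero    xy≡xx = xy≡xx
  ^⁺-square x y (suc k) xy≡xx =
    trans (assoc _ x y) (trans (cong (x ^⁺ k ∙_) xy≡xx) (sym (assoc _ x x)))

  ^⁺-leftFactor : ∀ s x k → ∃ λ y → (s ∙ x) ^⁺ k ≡ s ∙ y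
  ^⁺-leftFactor s x zero = x , refl
  ^⁺-leftFactor s x (suc k) with ^⁺-leftFactor s x k
  ... | y , eq = y ∙ (s ∙ x) , trans (cong (_∙ (s ∙ x)) eq) (assoc s y (s ∙ x))

module LeftRegularBandOfGroups
    {a : Level} {A : Set a} {_∙_ : A → A → A} {ω : A → A}
    (isSemigroup : IsSemigroup _≡_ _∙_)
    (ω-pow : ∀ s → ∃ λ k → ω s ≡ pow⁺ _∙_ s k)
    (isLRBG : IsLRBG _∙_ ω) where

  open IsSemigroup isSemigroup using (assoc)
  open PositivePowers isSemigroup

  ω-identityˡ : ∀ s → ω s ∙ s ≡ s
  ω-identityˡ = proj₁ isLRBG

  band : ∀ s t → (s ∙ t) ∙ ω s ≡ s ∙ t
  band = proj₂ isLRBG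

  ω-identityʳ : ∀ s → s ∙ ω s ≡ s
  ω-identityʳ s with ω-pow s
  ... | k , ωs≡sᵏ = begin
    s ∙ ω s        ≡⟨ cong (s ∙_) ωs≡sᵏ ⟩
    s ∙ s ^⁺ k     ≡⟨ ^⁺-comm s k ⟩
    s ^⁺ k ∙ s     ≡⟨ cong (_∙ s) (sym ωs≡sᵏ) ⟩
    ω s ∙ s        ≡⟨ ω-identityˡ s ⟩
    s              ∎

  ω-leftFactor : ∀ s x → ∃ λ y → ω (s ∙ x) ≡ s ∙ y
  ω-leftFactor s x with ω-pow (s ∙ x)
  ... | k , eq with ^⁺-leftFactor s x k
  ... | y , eq′ = y , trans eq eq′

  ω-absorbˡ : ∀ s x → ω s ∙ ω (s ∙ x) ≡ ω (s ∙ x)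
  ω-absorbˡ s x with ω-leftFactor s x
  ... | y , eq = begin
    ω s ∙ ω (s ∙ x)  ≡⟨ cong (ω s ∙_) eq ⟩
    ω s ∙ (s ∙ y)    ≡⟨ assoc _ _ _ ⟨
    (ω s ∙ s) ∙ y    ≡⟨ cong (_∙ y) (ω-identityˡ s) ⟩
    s ∙ y            ≡⟨ eq ⟨
    ω (s ∙ x)        ∎

  ω-absorbʳ : ∀ s x → ω (s ∙ x) ∙ ω s ≡ ω (s ∙ x)
  ω-absorbʳ s x with ω-leftFactor s x
  ... | y , eq = trans (cong (_∙ ω s) eq) (trans (band s y) (sym eq))

  ωs∙t≡s⇒ωs∙ωt≡ωs : ∀ s t → ω s ∙ t ≡ s → ω s ∙ ω t ≡ ω s
  ωs∙t≡s⇒ωs∙ωt≡ωs s t ωs∙t≡s with ω-pow s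
  ... | k , ωs≡sᵏ =
    trans (cong (_∙ ω t) ωs≡sᵏ) (trans (^⁺-fixʳ s (ω t) k s∙ωt≡s) (sym ωs≡sᵏ))
    where
    s∙ωt≡s : s ∙ ω t ≡ s
    s∙ωt≡s = begin
      s ∙ ω t            ≡⟨ cong (_∙ ω t) ωs∙t≡s ⟨
      (ω s ∙ t) ∙ ω t    ≡⟨ assoc _ _ _ ⟩
      ω s ∙ (t ∙ ω t)    ≡⟨ cong (ω s ∙_) (ω-identityʳ t) ⟩
      ω s ∙ t            ≡⟨ ωs∙t≡s ⟩
      s                  ∎

  x∙y≡x∙x⇒ωx∙y≡x : ∀ x y → x ∙ y ≡ x ∙ x → ω x ∙ y ≡ x
  x∙y≡x∙x⇒ωx∙y≡x x y xy≡xx with ω-pow x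
  ... | k , ωx≡xᵏ = begin
    ω x ∙ y         ≡⟨ cong (_∙ y) ωx≡xᵏ ⟩
    x ^⁺ k ∙ y      ≡⟨ ^⁺-square x y k xy≡xx ⟩
    x ^⁺ k ∙ x      ≡⟨ cong (_∙ x) ωx≡xᵏ ⟨
    ω x ∙ x         ≡⟨ ω-identityˡ x ⟩
    x               ∎

  _≤_ _∼_ : A → A → Set a
  _≤_ = Leq _∙_ ω
  _∼_ = Sim _∙_ ω

  ≤-trans : ∀ {s t u} → s ≤ t → t ≤ u → s ≤ u
  ≤-trans {s} {t} {u} s≤t t≤u = begin
    s ∙ ω u              ≡⟨ cong (s ∙_) ωt∙ωu≡ωu ⟨
    s ∙ (ω t ∙ ω u)      ≡⟨ assoc _ _ _ ⟨
    (s ∙ ω t) ∙ ω u      ≡⟨ cong (_∙ ω u) s≤t ⟩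
    t ∙ ω u              ≡⟨ t≤u ⟩
    u                    ∎
    where
    ωt∙ωu≡ωu : ω t ∙ ω u ≡ ω u
    ωt∙ωu≡ωu = subst (λ z → ω t ∙ ω z ≡ ω z) t≤u (ω-absorbˡ t (ω u))

  ≤-antisym : ∀ {s t} → s ≤ t → t ≤ s → s ≡ t
  ≤-antisym {s} {t} s≤t t≤s = begin
    s                    ≡⟨ t≤s ⟨
    t ∙ ω s              ≡⟨ band t (ω s) ⟨
    (t ∙ ω s) ∙ ω t      ≡⟨ cong (_∙ ω t) t≤s ⟩
    s ∙ ω t              ≡⟨ s≤t ⟩
    t                    ∎

  ≤-isPartialOrder : IsPartialOrder _≡_ _≤_
  ≤-isPartialOrder = record
    { isPreorder = record
      { isEquivalence = isEquivalence
      ; reflexive     = λ { {s} refl → ω-identityʳ s }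
      ; trans         = ≤-trans
      }
    ; antisym = ≤-antisym
    }

  ∼-sym : ∀ {s t} → s ∼ t → t ∼ s
  ∼-sym (ωs∙t≡s , ωt∙s≡t) = ωt∙s≡t , ωs∙t≡s

  ∼-transˡ : ∀ {s t u} → ω s ∙ t ≡ s → ω t ∙ u ≡ t → ω s ∙ u ≡ s
  ∼-transˡ {s} {t} {u} ωs∙t≡s ωt∙u≡t = begin
    ω s ∙ u              ≡⟨ cong (_∙ u) (ωs∙t≡s⇒ωs∙ωt≡ωs s t ωs∙t≡s) ⟨
    (ω s ∙ ω t) ∙ u      ≡⟨ assoc _ _ _ ⟩
    ω s ∙ (ω t ∙ u)      ≡⟨ cong (ω s ∙_) ωt∙u≡t ⟩
    ω s ∙ t              ≡⟨ ωs∙t≡s ⟩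
    s                    ∎

  ∼-trans : ∀ {s t u} → s ∼ t → t ∼ u → s ∼ u
  ∼-trans (ωs∙t≡s , ωt∙s≡t) (ωt∙u≡t , ωu∙t≡u) =
    ∼-transˡ ωs∙t≡s ωt∙u≡t , ∼-transˡ ωu∙t≡u ωt∙s≡t

  ∼-isEquivalence : IsEquivalence _∼_
  ∼-isEquivalence = record
    { refl  = λ {s} → ω-identityˡ s , ω-identityˡ s
    ; sym   = ∼-sym
    ; trans = ∼-trans
    }

  ∙-congʳ-half : ∀ s t u → s ∼ t → ω (s ∙ u) ∙ (t ∙ u) ≡ s ∙ u
  ∙-congʳ-half s t u (ωs∙t≡s , ωt∙s≡t) = begin
    ω (s ∙ u) ∙ (t ∙ u)            ≡⟨ cong (λ z → ω (s ∙ u) ∙ (z ∙ u)) ωt∙s≡t ⟨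
    ω (s ∙ u) ∙ ((ω t ∙ s) ∙ u)    ≡⟨ cong (ω (s ∙ u) ∙_) (assoc _ _ _) ⟩
    ω (s ∙ u) ∙ (ω t ∙ (s ∙ u))    ≡⟨ assoc _ _ _ ⟨
    (ω (s ∙ u) ∙ ω t) ∙ (s ∙ u)    ≡⟨ cong (_∙ (s ∙ u)) ωsu∙ωt≡ωsu ⟩
    ω (s ∙ u) ∙ (s ∙ u)            ≡⟨ ω-identityˡ (s ∙ u) ⟩
    s ∙ u                          ∎
    where
    ωsu∙ωt≡ωsu : ω (s ∙ u) ∙ ω t ≡ ω (s ∙ u)
    ωsu∙ωt≡ωsu = begin
      ω (s ∙ u) ∙ ω t              ≡⟨ cong (_∙ ω t) (ω-absorbʳ s u) ⟨
      (ω (s ∙ u) ∙ ω s) ∙ ω t      ≡⟨ assoc _ _ _ ⟩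
      ω (s ∙ u) ∙ (ω s ∙ ω t)      ≡⟨ cong (ω (s ∙ u) ∙_) (ωs∙t≡s⇒ωs∙ωt≡ωs s t ωs∙t≡s) ⟩
      ω (s ∙ u) ∙ ω s              ≡⟨ ω-absorbʳ s u ⟩
      ω (s ∙ u)                    ∎

  ∙-congˡ-half : ∀ s t u → s ∼ t → ω (u ∙ s) ∙ (u ∙ t) ≡ u ∙ s
  ∙-congˡ-half s t u (ωs∙t≡s , _) = x∙y≡x∙x⇒ωx∙y≡x (u ∙ s) (u ∙ t) us∙ut≡us∙us
    where
    s∙ut≡s∙us : s ∙ (u ∙ t) ≡ s ∙ (u ∙ s)
    s∙ut≡s∙us = begin
      s ∙ (u ∙ t)                  ≡⟨ assoc _ _ _ ⟨
      (s ∙ u) ∙ t                  ≡⟨ cong (_∙ t) (band s u) ⟨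
      ((s ∙ u) ∙ ω s) ∙ t          ≡⟨ assoc _ _ _ ⟩
      (s ∙ u) ∙ (ω s ∙ t)          ≡⟨ cong ((s ∙ u) ∙_) ωs∙t≡s ⟩
      (s ∙ u) ∙ s                  ≡⟨ assoc _ _ _ ⟩
      s ∙ (u ∙ s)                  ∎
    us∙ut≡us∙us : (u ∙ s) ∙ (u ∙ t) ≡ (u ∙ s) ∙ (u ∙ s)
    us∙ut≡us∙us = trans (assoc _ _ _) (trans (cong (u ∙_) s∙ut≡s∙us) (sym (assoc _ _ _)))

  ∼-isSemigroupCongruence : IsSemigroupCongruence _∙_ _∼_
  ∼-isSemigroupCongruence = ∼-isEquivalence , λ s t u s∼t →
    (∙-congʳ-half s t u s∼t , ∙-congʳ-half t s u (∼-sym s∼t)) ,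
    (∙-congˡ-half s t u s∼t , ∙-congˡ-half t s u (∼-sym s∼t))

proposition3p8 : {a : Level} (A : Set a) (_∙_ : A → A → A) (ω : A → A)
    → IsSemigroup _≡_ _∙_ → Finite A → IsOmega _∙_ ω → IsLRBG _∙_ ω
    → IsPartialOrder _≡_ (Leq _∙_ ω) × IsSemigroupCongruence _∙_ (Sim _∙_ ω)
proposition3p8 A _∙_ ω isSemigroup _ isOmega isLRBG =
  ≤-isPartialOrder , ∼-isSemigroupCongruence
  where open LeftRegularBandOfGroups isSemigroup (λ s → proj₂ (isOmega s)) isLRBG
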